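{- Let $n \geq 1$ and let $0 \leq m \leq n-1$ with $m$ even. Then $\Phi(\Delta_{n,m}) \subseteq S^D_{n,m}$, i.e. for every chain $C$ in $P_{n,m}$ (every face of $\Delta_{n,m}$), the signed permutation $\Phi(C)$ has an even number, at most $m$, of negative entries in window notation.
   Context: Sign vectors: elements of $\{ -,0,+\}^n$. For a sign vector $\omega$, $\operatorname{var}(\omega)$ is the number of sign changes in the sequence obtained from $\omega$ by deleting its zero entries, and $\operatorname{wt}(\omega)$ is the number of nonzero entries. $\mathcal{PV}_n$ is the set of nonzero sign vectors of length $n$ modulo $\omega \sim -\omega$ (var and wt are well defined on it). For $0 \leq m < n$, $P_{n,m}$ is the poset on $\{\omega \in \mathcal{PV}_n : \operatorname{var}(\omega) \leq m\}$ with $\omega' < \omega$ iff $\omega'$ or $-\omega'$ is obtained from $\omega$ by replacing some nonzero entries with $0$. $\Delta_{n,m}$ is the order complex of $P_{n,m}$; its faces are the chains $\omega^{(1)} < \cdots < \omega^{(r)}$, $r \geq 0$ (including the empty chain). Cyclic sign flips: indices are read cyclically ($\omega_{i+n} = \omega_i$); $i \in [n]$ is a cyclic sign flip of $\omega$ if there is $j \geq 1$ with $\omega_{i-j}\omega_i < 0$ and $\omega_{i-k}\omega_i = 0$ for $1 \leq k < j$. $\operatorname{BAR}(\omega)$ is the set of cyclic sign flips (so $\operatorname{BAR}(0^n) = \emptyset$). Signed permutations: a bijection $\pi$ of $\{\pm 1, \dots, \pm n\}$ with $\pi(-i) = -\pi(i)$, written in window notation $\pi(1)\pi(2)\cdots\pi(n)$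 (write $\bar{i}$ for $-i$). $S^D_n$ is the set of signed permutations with an even number of negative entries in window notation, and $S^D_{n,m}$ the set of those in $S^D_n$ with at most $m$ negative entries. The map $\Phi$: for a chain $C: \omega^{(1)} < \cdots < \omega^{(r)}$ in $P_{n,m}$ set $\omega^{(0)} = 0^n$ (choose representatives consistently; supports do not depend on this). For $s = 1, \dots, r$ let $I_s = \{i \in [n] : \omega^{(s)}_i \neq 0, \omega^{(s-1)}_i = 0\}$, and let $I_{r+1} = \{i \in [n] : \omega^{(r)}_i = 0\}$. For $1 \leq s \leq r+1$ let $\bar{I}_s = \{i : i \in I_s, i \notin \operatorname{BAR}(\omega^{(r)})\} \cup \{ -i : i \in I_s, i \in \operatorname{BAR}(\omega^{(r)})\}$, and let $\omega'_s$ be the word listing the elements of $\bar{I}_s$ in increasing order. Then $\Phi(C)$ is the signed permutation with window notation $\omega'_{r+1}\omega'_r\cdots\omega'_2\omega'_1$. -}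

module Defs where

open import Data.Bool using (Bool; true; false; _∧_; _∨_; not; if_then_else_)
open import Data.Nat using (ℕ; zero; suc; _+_; _∸_; _≤_; _<_)
open import Data.Nat.DivMod using (_mod_)
open import Data.Nat.Divisibility using (_∣_)
open import Data.Fin using (Fin; toℕ)
open import Data.Vec using (Vec; lookup; replicate; toList) renaming (map to vmap)
open import Data.List using (List; []; _∷_; filterᵇ; allFin; map; concat; reverse; length; upTo; applyUpTo)
open import Data.Bool.ListAction using (any; all)
open import Data.List.Relation.Unary.All using (All)
open import Data.List.Relation.Unary.Linked using (Linked)
open import Data.List.Relation.Binary.Permutation.Propositional using (_↭_)
open import Data.Integer using (ℤ; +_; -[1+_]; ∣_∣)
open import Data.Product using (_×_; ∃)
open import Data.Sum using (_⊎_)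
open import Relation.Binary.PropositionalEquality using (_≡_; _≢_)

-- Signs and sign vectors (sign vectors of length n are  Vec Sign n;
-- position  i : Fin n  stands for the paper's index  toℕ i + 1)

data Sign : Set where
  minus zer plus : Sign

negS : Sign → Sign
negS minus = plus
negS zer   = zer
negS plus  = minus

isZero : Sign → Bool
isZero zer = true
isZero _   = false

nonzeroS : Sign → Bool
nonzeroS s = not (isZero s)

oppB : Sign → Sign → Bool
oppB minus plus  = true
oppB plus  minus = true
oppB _     _     = false

zeroProdB : Sign → Sign → Bool
zeroProdB a b = isZero a ∨ isZero b

SV : ℕ → Set
SV n = Vec Sign n

negV : ∀ {n} → SV n → SV n
negV = vmap negS

deleteZeros : List Sign → List Sign
deleteZeros = filterᵇ nonzeroS

changes : List Sign → ℕ
changes []            = 0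
changes (a ∷ [])      = 0
changes (a ∷ b ∷ xs)  = (if oppB a b then 1 else 0) + changes (b ∷ xs)

var : ∀ {n} → SV n → ℕ
var ω = changes (deleteZeros (toList ω))

-- The poset P_{n,m} (elements represented by a representative vector)

NonZeroSV : ∀ {n} → SV n → Set
NonZeroSV {n} ω = ∃ λ (i : Fin n) → lookup ω i ≢ zer

Restricts : ∀ {n} → SV n → SV n → Set
Restricts {n} ω' ω = (i : Fin n) → (lookup ω' i ≡ zer) ⊎ (lookup ω' i ≡ lookup ω i)

-- strict order  ω' < ω  in PV_n : ω' or -ω' is obtained from ω by zeroing,
-- and the classes differ (i.e. some entry actually got zeroed)
_<PV_ : ∀ {n} → SV n → SV n → Set
_<PV_ {n} ω' ω =
  (Restricts ω' ω ⊎ Restricts (negV ω') ω) ×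
  (∃ λ (i : Fin n) → (lookup ω' i ≡ zer) × (lookup ω i ≢ zer))

InP : ∀ {n} → ℕ → SV n → Set
InP m ω = NonZeroSV ω × (var ω ≤ m)

-- a chain ω¹ < ω² < ... < ωʳ in P_{n,m} (a face of Δ_{n,m}), listed in
-- increasing order; the empty list is the empty chain
IsChain : ∀ {n} → ℕ → List (SV n) → Set
IsChain m C = All (InP m) C × Linked _<PV_ C

cyc : ∀ {n} → SV n → ℕ → Sign
cyc {zero}  ω k = zer
cyc {suc n} ω k = lookup ω (k mod suc n)

-- i is a cyclic sign flip: ∃ j ≥ 1 with ω_{i-j} ω_i < 0 and
-- ω_{i-k} ω_i = 0 for 1 ≤ k < j.  (j ranges over 1..n)
isFlip : ∀ {n} → SV n → Fin n → Bool
isFlip {n} ω i =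
  any (λ j → oppB (at j) (lookup ω i) ∧
             all (λ k → zeroProdB (at k) (lookup ω i)) (applyUpTo suc (j ∸ 1)))
      (applyUpTo suc n)
  where
    at : ℕ → Sign
    at j = cyc ω (toℕ i + n ∸ j)

zeroV : ∀ {n} → SV n
zeroV = replicate _ zer

newSupport : ∀ {n} → SV n → SV n → List (Fin n)
newSupport {n} prev cur =
  filterᵇ (λ i → nonzeroS (lookup cur i) ∧ isZero (lookup prev i)) (allFin n)

zeroSet : ∀ {n} → SV n → List (Fin n)
zeroSet {n} ω = filterᵇ (λ i → isZero (lookup ω i)) (allFin n)

-- [I_1, ..., I_r, I_{r+1}] given ω^(0) and the chain
blocks : ∀ {n} → SV n → List (SV n) → List (List (Fin n))
blocks prev []       = zeroSet prev ∷ []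
blocks prev (c ∷ cs) = newSupport prev c ∷ blocks c cs

-- top element ω^(r) (ω^(0) = 0^n for the empty chain)
top : ∀ {n} → SV n → List (SV n) → SV n
top prev []       = prev
top prev (c ∷ cs) = top c cs

signedIdx : ∀ {n} → SV n → Fin n → ℤ
signedIdx ω i = if isFlip ω i then -[1+ toℕ i ] else + suc (toℕ i)

-- window notation of Φ(C) : ω'_{r+1} ω'_r ... ω'_1
Φ : ∀ {n} → List (SV n) → List ℤ
Φ C = concat (reverse (map (map (signedIdx (top zeroV C))) (blocks zeroV C)))

isNeg : ℤ → Bool
isNeg -[1+ _ ] = true
isNeg (+ _)    = false

negCount : List ℤ → ℕ
negCount w = length (filterᵇ isNeg w)

IsSignedPerm : ℕ → List ℤ → Set
IsSignedPerm n w = map ∣_∣ w ↭ map suc (upTo n)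

InSD : ℕ → ℕ → List ℤ → Set
InSD n m w = IsSignedPerm n w × (2 ∣ negCount w) × (negCount w ≤ m)

{-# OPTIONS --safe #-}
-- The blocks I₁, …, I_{r+1} partition [n], because supports grow along a chain, so the
-- window of Φ(C) is a signed arrangement of 1, …, n whose negative entries are the
-- cyclic sign flips of the top element ω. Position i is a flip iff the nearest nonzero
-- entry cyclically before ωᵢ has the opposite sign, so the flips are the sign changes of
-- ω preceded by its last nonzero entry ℓ. There are at most var ω + 1 ≤ m + 1 of them,
-- and an even number, since negating ℓ once per change must end at ℓ again. As m is
-- even, there are at most m.
module Submission where

open import Defs
open import Data.Bool using (Bool; true; false; _∧_; _∨_; not; if_then_else_; T)
open import Data.Bool.Properties using (∨-assoc; ∨-identityʳ; ∨-zeroʳ; ∧-comm)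
open import Data.Bool.ListAction using (and; any; all)
open import Data.Empty using (⊥-elim)
open import Data.Fin using (Fin; toℕ) renaming (zero to fzero; suc to fsuc)
open import Data.Fin.Properties using (toℕ<n; toℕ-fromℕ<)
open import Data.Integer using (∣_∣)
open import Data.List using (List; []; _∷_; _++_; _∷ʳ_; [_]; foldr; applyUpTo; length; filterᵇ; tabulate; allFin; map; concat; reverse; upTo)
open import Data.List.Properties using (applyUpTo-∷ʳ; map-applyUpTo; map-upTo; map-tabulate; concat-map; filter-all; ++-identityʳ)
open import Data.List.Relation.Binary.Permutation.Propositional as ↭ using (_↭_; prep; swap; ↭-refl; ↭-trans; ↭-reflexive; module PermutationReasoning)
open import Data.List.Relation.Binary.Permutation.Propositional.Properties using (++⁺ˡ; shift; shifts; map⁺; filter-↭; ↭-length; ↭-reverse)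
open import Data.List.Relation.Unary.All using (All; _∷_; universal)
open import Data.List.Relation.Unary.Linked as Linked using (Linked; [-]; _∷_)
open import Data.Nat using (ℕ; zero; suc; _≤_; _<_; _+_; _∸_; _%_; z≤n; s≤s)
open import Data.Nat.DivMod using (_mod_; [m+n]%n≡m%n; m<n⇒m%n≡m)
open import Data.Nat.Divisibility using (_∣_; divides; ∣-refl; ∣m∣n⇒∣m+n; ∣m+n∣m⇒∣n; ∣1⇒≡1)
open import Data.Nat.GeneralisedArithmetic using (iterate)
open import Data.Nat.Properties
open import Data.Product using (_×_; _,_)
open import Data.Sum using (inj₁; inj₂)
open import Data.Unit using (tt)
open import Data.Vec using (lookup; toList) renaming ([] to []ᵛ; _∷_ to _∷ᵛ_)
open import Data.Vec.Properties using (lookup-map; lookup-replicate)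
open import Function using (_∘_; id)
open import Relation.Binary.PropositionalEquality using (_≡_; _≢_; refl; sym; trans; cong; cong₂; subst; module ≡-Reasoning)
open import Relation.Nullary using (contradiction)
open import Relation.Nullary.Decidable using (T?)

any-∷ʳ : ∀ {A : Set} (p : A → Bool) xs y → any p (xs ∷ʳ y) ≡ any p xs ∨ p y
any-∷ʳ p []       y = ∨-identityʳ (p y)
any-∷ʳ p (x ∷ xs) y = trans (cong (p x ∨_) (any-∷ʳ p xs y)) (sym (∨-assoc (p x) _ _))

applyUpTo-++ : ∀ {A : Set} (f : ℕ → A) m k → applyUpTo f (m + k) ≡ applyUpTo f m ++ applyUpTo (f ∘ (m +_)) k
applyUpTo-++ f zero    k = refl
applyUpTo-++ f (suc m) k = cong (f 0 ∷_) (applyUpTo-++ (f ∘ suc) m k)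

applyUpTo-cong : ∀ {A : Set} {f g : ℕ → A} N → (∀ {j} → j < N → f j ≡ g j) → applyUpTo f N ≡ applyUpTo g N
applyUpTo-cong zero    f≗g = refl
applyUpTo-cong (suc N) f≗g = cong₂ _∷_ (f≗g (s≤s z≤n)) (applyUpTo-cong N (f≗g ∘ s≤s))

tabulate-toℕ : ∀ {n} {A : Set} {f : Fin n → A} (g : ℕ → A) → (∀ i → f i ≡ g (toℕ i)) → tabulate f ≡ applyUpTo g n
tabulate-toℕ {zero}  g f≗g = refl
tabulate-toℕ {suc n} g f≗g = cong₂ _∷_ (f≗g fzero) (tabulate-toℕ (g ∘ suc) (f≗g ∘ fsuc))

concat⁺ : ∀ {A : Set} {xss yss : List (List A)} → xss ↭ yss → concat xss ↭ concat yss
concat⁺ ↭.refl         = ↭-refl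
concat⁺ (prep xs p)    = ++⁺ˡ xs (concat⁺ p)
concat⁺ (swap xs ys p) = ↭-trans (shifts xs ys) (++⁺ˡ ys (++⁺ˡ xs (concat⁺ p)))
concat⁺ (↭.trans p q)  = ↭-trans (concat⁺ p) (concat⁺ q)

filterᵇ-partition : ∀ {A : Set} (p q : A → Bool) → (∀ x → q x ≡ true → p x ≡ true) → ∀ xs →
  filterᵇ (λ x → not (q x) ∧ p x) xs ++ filterᵇ q xs ↭ filterᵇ p xs
filterᵇ-partition p q q⇒p []       = ↭-refl
filterᵇ-partition p q q⇒p (x ∷ xs) with q x in qx | p x in px
... | true  | true  = ↭-trans (shift x _ _) (prep x (filterᵇ-partition p q q⇒p xs))
... | true  | false = contradiction (trans (sym px) (q⇒p x qx)) λ ()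
... | false | true  = prep x (filterᵇ-partition p q q⇒p xs)
... | false | false = filterᵇ-partition p q q⇒p xs

countᵇ : ∀ {n} → (Fin n → Bool) → ℕ
countᵇ {zero}  P = 0
countᵇ {suc n} P = (if P fzero then 1 else 0) + countᵇ (P ∘ fsuc)

countᵇ-cong : ∀ {n} {P Q : Fin n → Bool} → (∀ i → P i ≡ Q i) → countᵇ P ≡ countᵇ Q
countᵇ-cong {zero}  P≗Q = refl
countᵇ-cong {suc n} P≗Q = cong₂ (λ b c → (if b then 1 else 0) + c) (P≗Q fzero) (countᵇ-cong (P≗Q ∘ fsuc))

length-filterᵇ-tabulate : ∀ {n} {A : Set} (p : A → Bool) (f : Fin n → A) →
  length (filterᵇ p (tabulate f)) ≡ countᵇ (p ∘ f)
length-filterᵇ-tabulate {zero}  p f = refl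
length-filterᵇ-tabulate {suc n} p f with p (f fzero)
... | true  = cong suc (length-filterᵇ-tabulate p (f ∘ fsuc))
... | false = length-filterᵇ-tabulate p (f ∘ fsuc)

infixr 6 _orElse_

_orElse_ : Sign → Sign → Sign
zer   orElse t = t
minus orElse t = minus
plus  orElse t = plus

orElse-assoc : ∀ a b c → (a orElse b) orElse c ≡ a orElse (b orElse c)
orElse-assoc zer   b c = refl
orElse-assoc minus b c = refl
orElse-assoc plus  b c = refl

orElse-identityʳ : ∀ a → a orElse zer ≡ a
orElse-identityʳ zer   = refl
orElse-identityʳ minus = refl
orElse-identityʳ plus  = refl

orElse-idem : ∀ a → a orElse a ≡ a
orElse-idem zer   = refl
orElse-idem minus = refl
orElse-idem plus  = refl

orElse-absorbʳ : ∀ a b → a orElse (b orElse a) ≡ a orElse b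
orElse-absorbʳ zer   b = orElse-identityʳ b
orElse-absorbʳ minus b = refl
orElse-absorbʳ plus  b = refl

orElse-nonzero : ∀ a {b} → b ≢ zer → a orElse b ≢ zer
orElse-nonzero zer   b≢0 = b≢0
orElse-nonzero minus _   ()
orElse-nonzero plus  _   ()

orElse≡zer : ∀ {a b} → a orElse b ≡ zer → a ≡ zer × b ≡ zer
orElse≡zer {zer} b≡0 = refl , b≡0

oppB-zerʳ : ∀ a → oppB a zer ≡ false
oppB-zerʳ zer   = refl
oppB-zerʳ minus = refl
oppB-zerʳ plus  = refl

oppB-orElse : ∀ a b x → oppB (a orElse b) x ≡ oppB a x ∨ (zeroProdB a x ∧ oppB b x)
oppB-orElse zer   b x     = refl
oppB-orElse minus b minus = refl
oppB-orElse minus b zer   = sym (oppB-zerʳ b)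
oppB-orElse minus b plus  = refl
oppB-orElse plus  b minus = refl
oppB-orElse plus  b zer   = sym (oppB-zerʳ b)
oppB-orElse plus  b plus  = refl

zeroProdB-orElse : ∀ a b x → zeroProdB (a orElse b) x ≡ zeroProdB a x ∧ zeroProdB b x
zeroProdB-orElse zer   b x     = refl
zeroProdB-orElse minus b minus = refl
zeroProdB-orElse minus b zer   = sym (∨-zeroʳ (isZero b))
zeroProdB-orElse minus b plus  = refl
zeroProdB-orElse plus  b minus = refl
zeroProdB-orElse plus  b zer   = sym (∨-zeroʳ (isZero b))
zeroProdB-orElse plus  b plus  = refl

isZero-negS : ∀ a → isZero (negS a) ≡ isZero a
isZero-negS zer   = refl
isZero-negS minus = refl
isZero-negS plus  = refl

firstNonzero : List Sign → Sign
firstNonzero = foldr _orElse_ zer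

firstNonzero-++ : ∀ xs ys → firstNonzero (xs ++ ys) ≡ firstNonzero xs orElse firstNonzero ys
firstNonzero-++ []       ys = refl
firstNonzero-++ (x ∷ xs) ys =
  trans (cong (x orElse_) (firstNonzero-++ xs ys)) (sym (orElse-assoc x _ _))

firstNonzero-∷ʳ : ∀ xs y → firstNonzero (xs ∷ʳ y) ≡ firstNonzero xs orElse y
firstNonzero-∷ʳ xs y =
  trans (firstNonzero-++ xs [ y ]) (cong (firstNonzero xs orElse_) (orElse-identityʳ y))

all-zeroProdB : ∀ x ys → all (λ s → zeroProdB s x) ys ≡ zeroProdB (firstNonzero ys) x
all-zeroProdB x []       = refl
all-zeroProdB x (y ∷ ys) =
  trans (cong (zeroProdB y x ∧_) (all-zeroProdB x ys)) (sym (zeroProdB-orElse y _ x))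

lastNonzeroBelow : (ℕ → Sign) → ℕ → Sign
lastNonzeroBelow g zero    = zer
lastNonzeroBelow g (suc p) = g p orElse lastNonzeroBelow g p

lastNonzeroBelow-suc : ∀ g p → lastNonzeroBelow g (suc p) ≡ lastNonzeroBelow (g ∘ suc) p orElse g 0
lastNonzeroBelow-suc g zero    = orElse-identityʳ (g 0)
lastNonzeroBelow-suc g (suc p) =
  trans (cong (g (suc p) orElse_) (lastNonzeroBelow-suc g p)) (sym (orElse-assoc (g (suc p)) _ (g 0)))

firstNonzero-downFrom : ∀ g p → firstNonzero (applyUpTo (λ j → g (p ∸ suc j)) p) ≡ lastNonzeroBelow g p
firstNonzero-downFrom g zero    = refl
firstNonzero-downFrom g (suc p) = cong (g p orElse_) (firstNonzero-downFrom g p)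

lastNonzeroBelow-split : ∀ g {p n} → p ≤ n →
  lastNonzeroBelow g n ≡ firstNonzero (applyUpTo (λ j → g (n ∸ suc j)) (n ∸ p)) orElse lastNonzeroBelow g p
lastNonzeroBelow-split g {p} {n} p≤n =
  subst (λ m → lastNonzeroBelow g m ≡ firstNonzero (applyUpTo (λ j → g (m ∸ suc j)) (n ∸ p)) orElse lastNonzeroBelow g p)
        (m∸n+n≡m p≤n) (split+ (n ∸ p))
  where
  split+ : ∀ k → lastNonzeroBelow g (k + p) ≡ firstNonzero (applyUpTo (λ j → g (k + p ∸ suc j)) k) orElse lastNonzeroBelow g p
  split+ zero    = refl
  split+ (suc k) = trans (cong (g (k + p) orElse_) (split+ k)) (sym (orElse-assoc (g (k + p)) _ _))

-- Cyclic sign flips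

any-oppB-after-zeros : ∀ (h : ℕ → Sign) x N →
  any (λ j → oppB (h j) x ∧ all (λ k → zeroProdB (h k) x) (applyUpTo suc (j ∸ 1))) (applyUpTo suc N)
    ≡ oppB (firstNonzero (applyUpTo (h ∘ suc) N)) x
any-oppB-after-zeros h x zero    = refl
any-oppB-after-zeros h x (suc N) = begin
  any P (applyUpTo suc (suc N))
    ≡⟨ cong (any P) (sym (applyUpTo-∷ʳ suc N)) ⟩
  any P (applyUpTo suc N ∷ʳ suc N)
    ≡⟨ any-∷ʳ P (applyUpTo suc N) (suc N) ⟩
  any P (applyUpTo suc N) ∨ (oppB (h (suc N)) x ∧ all (λ k → zeroProdB (h k) x) (applyUpTo suc N))
    ≡⟨ cong₂ (λ u v → u ∨ (oppB (h (suc N)) x ∧ v)) (any-oppB-after-zeros h x N) earlierZero ⟩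
  oppB a x ∨ (oppB (h (suc N)) x ∧ zeroProdB a x)
    ≡⟨ cong (oppB a x ∨_) (∧-comm (oppB (h (suc N)) x) _) ⟩
  oppB a x ∨ (zeroProdB a x ∧ oppB (h (suc N)) x)
    ≡⟨ sym (oppB-orElse a (h (suc N)) x) ⟩
  oppB (a orElse h (suc N)) x
    ≡⟨ cong (λ s → oppB s x) (sym (firstNonzero-∷ʳ (applyUpTo (h ∘ suc) N) (h (suc N)))) ⟩
  oppB (firstNonzero (applyUpTo (h ∘ suc) N ∷ʳ h (suc N))) x
    ≡⟨ cong (λ l → oppB (firstNonzero l) x) (applyUpTo-∷ʳ (h ∘ suc) N) ⟩
  oppB (firstNonzero (applyUpTo (h ∘ suc) (suc N))) x ∎
  where
  open ≡-Reasoning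
  P : ℕ → Bool
  P j = oppB (h j) x ∧ all (λ k → zeroProdB (h k) x) (applyUpTo suc (j ∸ 1))
  a : Sign
  a = firstNonzero (applyUpTo (h ∘ suc) N)
  earlierZero : all (λ k → zeroProdB (h k) x) (applyUpTo suc N) ≡ zeroProdB a x
  earlierZero = trans (cong and (trans (map-applyUpTo suc _ N) (sym (map-applyUpTo (h ∘ suc) _ N))))
                      (all-zeroProdB x (applyUpTo (h ∘ suc) N))

entry : ∀ {n} → SV n → ℕ → Sign
entry []ᵛ      k       = zer
entry (x ∷ᵛ ω) zero    = x
entry (x ∷ᵛ ω) (suc k) = entry ω k

lookup-entry : ∀ {n} (ω : SV n) i → lookup ω i ≡ entry ω (toℕ i)
lookup-entry (x ∷ᵛ ω) fzero    = refl
lookup-entry (x ∷ᵛ ω) (fsuc i) = lookup-entry ω i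

lastNonzero : ∀ {n} → SV n → Sign
lastNonzero {n} ω = lastNonzeroBelow (entry ω) n

lastNonzero-∷ : ∀ {n} x (ω : SV n) → lastNonzero (x ∷ᵛ ω) ≡ lastNonzero ω orElse x
lastNonzero-∷ {n} x ω = lastNonzeroBelow-suc (entry (x ∷ᵛ ω)) n

module _ {n : ℕ} (ω : SV (suc n)) where

  cyc-% : ∀ k → cyc ω k ≡ entry ω (k % suc n)
  cyc-% k = trans (lookup-entry ω (k mod suc n)) (cong (entry ω) (toℕ-fromℕ< _))

  cyc-< : ∀ {k} → k < suc n → cyc ω k ≡ entry ω k
  cyc-< {k} k<n = trans (cyc-% k) (cong (entry ω) (m<n⇒m%n≡m k<n))

  cyc-periodic : ∀ k → cyc ω (k + suc n) ≡ cyc ω k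
  cyc-periodic k = trans (cyc-% (k + suc n)) (trans (cong (entry ω) ([m+n]%n≡m%n k (suc n))) (sym (cyc-% k)))

  cyc-predecessors : ∀ {p} → p < suc n →
    applyUpTo (λ j → cyc ω (p + suc n ∸ suc j)) (suc n)
      ≡ applyUpTo (λ j → entry ω (p ∸ suc j)) p ++ applyUpTo (λ j → entry ω (suc n ∸ suc j)) (suc n ∸ p)
  cyc-predecessors {p} p<N = begin
    applyUpTo H N                               ≡⟨ cong (applyUpTo H) (sym (m+[n∸m]≡n (<⇒≤ p<N))) ⟩
    applyUpTo H (p + (N ∸ p))                   ≡⟨ applyUpTo-++ H p (N ∸ p) ⟩
    applyUpTo H p ++ applyUpTo (H ∘ (p +_)) (N ∸ p)
      ≡⟨ cong₂ _++_ (applyUpTo-cong p before) (applyUpTo-cong (N ∸ p) after) ⟩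
    applyUpTo (λ j → entry ω (p ∸ suc j)) p ++ applyUpTo (λ j → entry ω (N ∸ suc j)) (N ∸ p) ∎
    where
    open ≡-Reasoning
    N = suc n
    H : ℕ → Sign
    H j = cyc ω (p + N ∸ suc j)
    before : ∀ {j} → j < p → H j ≡ entry ω (p ∸ suc j)
    before {j} j<p = begin
      cyc ω (p + N ∸ suc j)   ≡⟨ cong (cyc ω) (+-∸-comm N j<p) ⟩
      cyc ω (p ∸ suc j + N)   ≡⟨ cyc-periodic (p ∸ suc j) ⟩
      cyc ω (p ∸ suc j)       ≡⟨ cyc-< (≤-<-trans (m∸n≤m p (suc j)) p<N) ⟩
      entry ω (p ∸ suc j)     ∎
    after : ∀ {j} → j < N ∸ p → H (p + j) ≡ entry ω (N ∸ suc j)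
    after {j} _ = begin
      cyc ω (p + N ∸ suc (p + j))   ≡⟨ cong (λ k → cyc ω (p + N ∸ k)) (sym (+-suc p j)) ⟩
      cyc ω (p + N ∸ (p + suc j))   ≡⟨ cong (cyc ω) ([m+n]∸[m+o]≡n∸o p N (suc j)) ⟩
      cyc ω (N ∸ suc j)             ≡⟨ cyc-< (s≤s (m∸n≤m n j)) ⟩
      entry ω (N ∸ suc j)           ∎

isFlip-lastNonzero : ∀ {n} (ω : SV n) i →
  isFlip ω i ≡ oppB (lastNonzeroBelow (entry ω) (toℕ i) orElse lastNonzero ω) (lookup ω i)
isFlip-lastNonzero {suc n} ω i = begin
  isFlip ω i
    ≡⟨ any-oppB-after-zeros (λ j → cyc ω (p + N ∸ j)) x N ⟩
  oppB (firstNonzero (applyUpTo (λ j → cyc ω (p + N ∸ suc j)) N)) x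
    ≡⟨ cong (λ l → oppB (firstNonzero l) x) (cyc-predecessors ω (toℕ<n i)) ⟩
  oppB (firstNonzero (applyUpTo (λ j → g (p ∸ suc j)) p ++ later)) x
    ≡⟨ cong (λ s → oppB s x) (firstNonzero-++ (applyUpTo (λ j → g (p ∸ suc j)) p) later) ⟩
  oppB (firstNonzero (applyUpTo (λ j → g (p ∸ suc j)) p) orElse firstNonzero later) x
    ≡⟨ cong (λ s → oppB (s orElse firstNonzero later) x) (firstNonzero-downFrom g p) ⟩
  oppB (lastNonzeroBelow g p orElse firstNonzero later) x
    ≡⟨ cong (λ s → oppB s x) (sym (orElse-absorbʳ (lastNonzeroBelow g p) (firstNonzero later))) ⟩
  oppB (lastNonzeroBelow g p orElse (firstNonzero later orElse lastNonzeroBelow g p)) x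
    ≡⟨ cong (λ s → oppB (lastNonzeroBelow g p orElse s) x) (sym (lastNonzeroBelow-split g (<⇒≤ (toℕ<n i)))) ⟩
  oppB (lastNonzeroBelow g p orElse lastNonzero ω) x ∎
  where
  open ≡-Reasoning
  N = suc n
  p = toℕ i
  x = lookup ω i
  g = entry ω
  later = applyUpTo (λ j → g (N ∸ suc j)) (N ∸ p)

-- Counting cyclic sign changes

cyclicVar : ∀ {n} → SV n → ℕ
cyclicVar ω = changes (deleteZeros (lastNonzero ω ∷ toList ω))

changes-deleteZeros-∷ : ∀ s x L →
  (if oppB s x then 1 else 0) + changes (deleteZeros (x orElse s ∷ L)) ≡ changes (deleteZeros (s ∷ x ∷ L))
changes-deleteZeros-∷ zer   zer   L = refl
changes-deleteZeros-∷ zer   minus L = refl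
changes-deleteZeros-∷ zer   plus  L = refl
changes-deleteZeros-∷ minus zer   L = refl
changes-deleteZeros-∷ minus minus L = refl
changes-deleteZeros-∷ minus plus  L = refl
changes-deleteZeros-∷ plus  zer   L = refl
changes-deleteZeros-∷ plus  minus L = refl
changes-deleteZeros-∷ plus  plus  L = refl

countᵇ-scan : ∀ {n} (ω : SV n) s →
  countᵇ (λ i → oppB (lastNonzeroBelow (entry ω) (toℕ i) orElse s) (lookup ω i))
    ≡ changes (deleteZeros (s ∷ toList ω))
countᵇ-scan []ᵛ zer   = refl
countᵇ-scan []ᵛ minus = refl
countᵇ-scan []ᵛ plus  = refl
countᵇ-scan (x ∷ᵛ ω) s = begin
  (if oppB s x then 1 else 0) + countᵇ (λ i → oppB (lastNonzeroBelow (entry (x ∷ᵛ ω)) (suc (toℕ i)) orElse s) (lookup ω i))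
    ≡⟨ cong (_ +_) (countᵇ-cong shiftState) ⟩
  (if oppB s x then 1 else 0) + countᵇ (λ i → oppB (lastNonzeroBelow (entry ω) (toℕ i) orElse (x orElse s)) (lookup ω i))
    ≡⟨ cong (_ +_) (countᵇ-scan ω (x orElse s)) ⟩
  (if oppB s x then 1 else 0) + changes (deleteZeros (x orElse s ∷ toList ω))
    ≡⟨ changes-deleteZeros-∷ s x (toList ω) ⟩
  changes (deleteZeros (s ∷ x ∷ toList ω)) ∎
  where
  open ≡-Reasoning
  shiftState : ∀ i → oppB (lastNonzeroBelow (entry (x ∷ᵛ ω)) (suc (toℕ i)) orElse s) (lookup ω i)
                   ≡ oppB (lastNonzeroBelow (entry ω) (toℕ i) orElse (x orElse s)) (lookup ω i)
  shiftState i = cong (λ t → oppB t (lookup ω i))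
    (trans (cong (_orElse s) (lastNonzeroBelow-suc (entry (x ∷ᵛ ω)) (toℕ i))) (orElse-assoc _ x s))

countᵇ-isFlip : ∀ {n} (ω : SV n) → countᵇ (isFlip ω) ≡ cyclicVar ω
countᵇ-isFlip ω = trans (countᵇ-cong (isFlip-lastNonzero ω)) (countᵇ-scan ω (lastNonzero ω))

changes-∷-≤ : ∀ a xs → changes (a ∷ xs) ≤ suc (changes xs)
changes-∷-≤ a []       = z≤n
changes-∷-≤ a (b ∷ xs) with oppB a b
... | true  = ≤-refl
... | false = n≤1+n _

changes-deleteZeros-∷-≤ : ∀ s L → changes (deleteZeros (s ∷ L)) ≤ suc (changes (deleteZeros L))
changes-deleteZeros-∷-≤ zer   L = n≤1+n _
changes-deleteZeros-∷-≤ minus L = changes-∷-≤ minus (deleteZeros L)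
changes-deleteZeros-∷-≤ plus  L = changes-∷-≤ plus (deleteZeros L)

iterate-+ : ∀ {A : Set} (f : A → A) x m k → iterate f x (m + k) ≡ iterate f (iterate f x m) k
iterate-+ f x zero    k = refl
iterate-+ f x (suc m) k = iterate-+ f (f x) m k

iterate-negS-oppB : ∀ {s} x → s ≢ zer → iterate negS s (if oppB s x then 1 else 0) ≡ x orElse s
iterate-negS-oppB {zer}   x     s≢0 = ⊥-elim (s≢0 refl)
iterate-negS-oppB {minus} zer   _   = refl
iterate-negS-oppB {minus} minus _   = refl
iterate-negS-oppB {minus} plus  _   = refl
iterate-negS-oppB {plus}  zer   _   = refl
iterate-negS-oppB {plus}  minus _   = refl
iterate-negS-oppB {plus}  plus  _   = refl

iterate-negS-changes : ∀ {n} (ω : SV n) {s} → s ≢ zer →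
  iterate negS s (changes (deleteZeros (s ∷ toList ω))) ≡ lastNonzero ω orElse s
iterate-negS-changes []ᵛ {zer}   s≢0 = ⊥-elim (s≢0 refl)
iterate-negS-changes []ᵛ {minus} _   = refl
iterate-negS-changes []ᵛ {plus}  _   = refl
iterate-negS-changes (x ∷ᵛ ω) {s} s≢0 = begin
  iterate negS s (changes (deleteZeros (s ∷ x ∷ L)))
    ≡⟨ cong (iterate negS s) (sym (changes-deleteZeros-∷ s x L)) ⟩
  iterate negS s ((if oppB s x then 1 else 0) + changes (deleteZeros (x orElse s ∷ L)))
    ≡⟨ iterate-+ negS s (if oppB s x then 1 else 0) _ ⟩
  iterate negS (iterate negS s (if oppB s x then 1 else 0)) (changes (deleteZeros (x orElse s ∷ L)))
    ≡⟨ cong (λ t → iterate negS t (changes (deleteZeros (x orElse s ∷ L)))) (iterate-negS-oppB x s≢0) ⟩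
  iterate negS (x orElse s) (changes (deleteZeros (x orElse s ∷ L)))
    ≡⟨ iterate-negS-changes ω (orElse-nonzero x s≢0) ⟩
  lastNonzero ω orElse x orElse s
    ≡⟨ sym (orElse-assoc (lastNonzero ω) x s) ⟩
  (lastNonzero ω orElse x) orElse s
    ≡⟨ cong (_orElse s) (sym (lastNonzero-∷ x ω)) ⟩
  lastNonzero (x ∷ᵛ ω) orElse s ∎
  where
  open ≡-Reasoning
  L = toList ω

iterate-negS-fixed⇒even : ∀ {s} k → s ≢ zer → iterate negS s k ≡ s → 2 ∣ k
iterate-negS-fixed⇒even {zer}   _             s≢0 _   = ⊥-elim (s≢0 refl)
iterate-negS-fixed⇒even         zero          _   _   = divides 0 refl
iterate-negS-fixed⇒even {minus} (suc zero)    _   ()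
iterate-negS-fixed⇒even {plus}  (suc zero)    _   ()
iterate-negS-fixed⇒even {minus} (suc (suc k)) s≢0 fix = ∣m∣n⇒∣m+n ∣-refl (iterate-negS-fixed⇒even k s≢0 fix)
iterate-negS-fixed⇒even {plus}  (suc (suc k)) s≢0 fix = ∣m∣n⇒∣m+n ∣-refl (iterate-negS-fixed⇒even k s≢0 fix)

lastNonzero≡zer⇒deleteZeros≡[] : ∀ {n} (ω : SV n) → lastNonzero ω ≡ zer → deleteZeros (toList ω) ≡ []
lastNonzero≡zer⇒deleteZeros≡[] []ᵛ      _  = refl
lastNonzero≡zer⇒deleteZeros≡[] (x ∷ᵛ ω) ≡0 with orElse≡zer {lastNonzero ω} {x} (trans (sym (lastNonzero-∷ x ω)) ≡0)
... | ω≡0 , refl = lastNonzero≡zer⇒deleteZeros≡[] ω ω≡0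

changes-from-lastNonzero-even : ∀ {n} (ω : SV n) {s} → s ≢ zer → lastNonzero ω ≡ s →
  2 ∣ changes (deleteZeros (s ∷ toList ω))
changes-from-lastNonzero-even ω {s} s≢0 last≡s = iterate-negS-fixed⇒even _ s≢0
  (trans (iterate-negS-changes ω s≢0) (trans (cong (_orElse s) last≡s) (orElse-idem s)))

cyclicVar-even : ∀ {n} (ω : SV n) → 2 ∣ cyclicVar ω
cyclicVar-even ω with lastNonzero ω in last≡
... | zer   rewrite lastNonzero≡zer⇒deleteZeros≡[] ω last≡ = divides 0 refl
... | minus = changes-from-lastNonzero-even ω (λ ()) last≡
... | plus  = changes-from-lastNonzero-even ω (λ ()) last≡

even-≤-suc : ∀ {k m} → 2 ∣ k → 2 ∣ m → k ≤ suc m → k ≤ m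
even-≤-suc {k} {m} 2∣k 2∣m k≤1+m with m≤n⇒m<n∨m≡n k≤1+m
... | inj₁ k<1+m = m<1+n⇒m≤n k<1+m
... | inj₂ refl  = contradiction (∣1⇒≡1 (∣m+n∣m⇒∣n (subst (2 ∣_) (+-comm 1 m) 2∣k) 2∣m)) λ ()

cyclicVar-≤ : ∀ {n m} (ω : SV n) → var ω ≤ m → 2 ∣ m → cyclicVar ω ≤ m
cyclicVar-≤ ω var≤m 2∣m = even-≤-suc (cyclicVar-even ω) 2∣m
  (≤-trans (changes-deleteZeros-∷-≤ (lastNonzero ω) (toList ω)) (s≤s var≤m))

-- The window of Φ(C)

_≼_ : ∀ {n} → SV n → SV n → Set
ω′ ≼ ω = ∀ i → isZero (lookup ω i) ≡ true → isZero (lookup ω′ i) ≡ true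

restricts⇒≼ : ∀ {n} (ω′ ω : SV n) → Restricts ω′ ω → ω′ ≼ ω
restricts⇒≼ ω′ ω r i ω≡0 with r i
... | inj₁ ω′≡zer = cong isZero ω′≡zer
... | inj₂ ω′≡ω   = trans (cong isZero ω′≡ω) ω≡0

negV-≼ : ∀ {n} (ω′ ω : SV n) → negV ω′ ≼ ω → ω′ ≼ ω
negV-≼ ω′ ω r i ω≡0 =
  trans (sym (isZero-negS (lookup ω′ i))) (trans (cong isZero (sym (lookup-map i negS ω′))) (r i ω≡0))

<PV⇒≼ : ∀ {n} (ω′ ω : SV n) → ω′ <PV ω → ω′ ≼ ω
<PV⇒≼ ω′ ω (inj₁ r , _) = restricts⇒≼ ω′ ω r
<PV⇒≼ ω′ ω (inj₂ r , _) = negV-≼ ω′ ω (restricts⇒≼ (negV ω′) ω r)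

zeroV-≼ : ∀ {n} (ω : SV n) → zeroV ≼ ω
zeroV-≼ ω i _ = cong isZero (lookup-replicate i zer)

newSupport-++-zeroSet : ∀ {n} (ω′ ω : SV n) → ω′ ≼ ω → newSupport ω′ ω ++ zeroSet ω ↭ zeroSet ω′
newSupport-++-zeroSet {n} ω′ ω ω′≼ω =
  filterᵇ-partition (λ i → isZero (lookup ω′ i)) (λ i → isZero (lookup ω i)) ω′≼ω (allFin n)

concat-blocks : ∀ {n} (prev : SV n) cs → Linked _≼_ (prev ∷ cs) → concat (blocks prev cs) ↭ zeroSet prev
concat-blocks prev []       _              = ↭-reflexive (++-identityʳ (zeroSet prev))
concat-blocks prev (c ∷ cs) (prev≼c ∷ chain) =
  ↭-trans (++⁺ˡ (newSupport prev c) (concat-blocks c cs chain)) (newSupport-++-zeroSet prev c prev≼c)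

zeroSet-zeroV : ∀ n → zeroSet (zeroV {n}) ≡ allFin n
zeroSet-zeroV n = filter-all (T? ∘ λ i → isZero (lookup (zeroV {n}) i))
  (universal (λ i → subst (T ∘ isZero) (sym (lookup-replicate i zer)) tt) (allFin n))

zeroV-∷-chain : ∀ {n} (C : List (SV n)) → Linked _<PV_ C → Linked _≼_ (zeroV ∷ C)
zeroV-∷-chain []      _     = [-]
zeroV-∷-chain (c ∷ C) chain = zeroV-≼ c ∷ Linked.map (λ {ω′ ω} → <PV⇒≼ ω′ ω) chain

Φ-↭ : ∀ {n} (C : List (SV n)) → Linked _<PV_ C → Φ C ↭ map (signedIdx (top zeroV C)) (allFin n)
Φ-↭ {n} C chain = begin
  concat (reverse (map (map f) (blocks zeroV C))) ↭⟨ concat⁺ (↭-reverse (map (map f) (blocks zeroV C))) ⟩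
  concat (map (map f) (blocks zeroV C))           ≡⟨ concat-map (blocks zeroV C) ⟩
  map f (concat (blocks zeroV C))                 ↭⟨ map⁺ f (concat-blocks zeroV C (zeroV-∷-chain C chain)) ⟩
  map f (zeroSet zeroV)                           ≡⟨ cong (map f) (zeroSet-zeroV n) ⟩
  map f (allFin n)                                ∎
  where
  open PermutationReasoning
  f = signedIdx (top zeroV C)

∣signedIdx∣ : ∀ {n} (ω : SV n) i → ∣ signedIdx ω i ∣ ≡ suc (toℕ i)
∣signedIdx∣ ω i with isFlip ω i
... | true  = refl
... | false = refl

isNeg-signedIdx : ∀ {n} (ω : SV n) i → isNeg (signedIdx ω i) ≡ isFlip ω i
isNeg-signedIdx ω i with isFlip ω i
... | true  = refl
... | false = refl

signedIdx-isSignedPerm : ∀ {n} (ω : SV n) → IsSignedPerm n (map (signedIdx ω) (allFin n))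
signedIdx-isSignedPerm {n} ω = ↭-reflexive (begin
  map ∣_∣ (map (signedIdx ω) (allFin n)) ≡⟨ cong (map ∣_∣) (map-tabulate id (signedIdx ω)) ⟩
  map ∣_∣ (tabulate (signedIdx ω))       ≡⟨ map-tabulate (signedIdx ω) ∣_∣ ⟩
  tabulate (∣_∣ ∘ signedIdx ω)           ≡⟨ tabulate-toℕ suc (∣signedIdx∣ ω) ⟩
  applyUpTo suc n                        ≡⟨ map-upTo suc n ⟨
  map suc (upTo n)                       ∎)
  where open ≡-Reasoning

negCount-signedIdx : ∀ {n} (ω : SV n) → negCount (map (signedIdx ω) (allFin n)) ≡ cyclicVar ω
negCount-signedIdx {n} ω = begin
  length (filterᵇ isNeg (map (signedIdx ω) (allFin n))) ≡⟨ cong (length ∘ filterᵇ isNeg) (map-tabulate id (signedIdx ω)) ⟩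
  length (filterᵇ isNeg (tabulate (signedIdx ω)))       ≡⟨ length-filterᵇ-tabulate isNeg (signedIdx ω) ⟩
  countᵇ (isNeg ∘ signedIdx ω)                          ≡⟨ countᵇ-cong (isNeg-signedIdx ω) ⟩
  countᵇ (isFlip ω)                                     ≡⟨ countᵇ-isFlip ω ⟩
  cyclicVar ω                                           ∎
  where open ≡-Reasoning

negCount-↭ : ∀ {xs ys} → xs ↭ ys → negCount xs ≡ negCount ys
negCount-↭ xs↭ys = ↭-length (filter-↭ (T? ∘ isNeg) xs↭ys)

var-zeroV : ∀ n → var (zeroV {n}) ≡ 0
var-zeroV zero    = refl
var-zeroV (suc n) = var-zeroV n

var-top : ∀ {n m} (prev : SV n) cs → var prev ≤ m → All (InP m) cs → var (top prev cs) ≤ m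
var-top prev []       var≤m _                 = var≤m
var-top prev (c ∷ cs) _     ((_ , var≤m) ∷ P) = var-top c cs var≤m P

lemma3p5 : (n m : ℕ) → 1 ≤ n → m < n → 2 ∣ m →
    (C : List (SV n)) → IsChain m C → InSD n m (Φ C)
lemma3p5 n m _ _ 2∣m C (inP , chain) =
  ↭-trans (map⁺ ∣_∣ Φ↭) (signedIdx-isSignedPerm ω) ,
  subst (2 ∣_) (sym negCount≡) (cyclicVar-even ω) ,
  subst (_≤ m) (sym negCount≡) (cyclicVar-≤ ω var≤m 2∣m)
  where
  ω = top zeroV C
  Φ↭ : Φ C ↭ map (signedIdx ω) (allFin n)
  Φ↭ = Φ-↭ C chain
  negCount≡ : negCount (Φ C) ≡ cyclicVar ω
  negCount≡ = trans (negCount-↭ Φ↭) (negCount-signedIdx ω)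
  var≤m : var ω ≤ m
  var≤m = var-top zeroV C (subst (_≤ m) (sym (var-zeroV n)) z≤n) inP
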